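{- Let $p$ be a prime and let $G=\Gamma(\mathbb{Z}_{p}[x]/\langle x^{4}\rangle)$ be the zero divisor graph of $\mathbb{Z}_{p}[x]/\langle x^{4}\rangle$. Then \[ \frac{M_{2}(G)}{|E(G)|}\geq\frac{M_{1}(G)}{|V(G)|}. \]
   Context: For a commutative ring $R$ with nonzero identity, the zero divisor graph $\Gamma(R)$ is the simple graph whose vertex set is the set of nonzero zero divisors of $R$, two distinct vertices $x,y$ being adjacent if and only if $x\cdot y=0$. For a graph $G$ with vertex degrees $d_{x}$, the first Zagreb index is $M_{1}(G)=\sum_{xy\in E(G)}(d_{x}+d_{y})$ and the second Zagreb index is $M_{2}(G)=\sum_{xy\in E(G)}d_{x}d_{y}$. -}

module Defs where

open import Data.Nat using (ℕ; zero; suc; _+_; _*_; NonZero)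
open import Data.Nat.DivMod using (_mod_)
open import Data.Fin using (Fin; toℕ)
import Data.Fin as Fin
open import Data.Vec using (Vec; []; _∷_)
open import Data.Vec.Properties using (≡-dec)
open import Data.List using (List; []; _∷_; map; concatMap; filter; length; allFin; _++_)
open import Data.Nat.ListAction using (sum)
open import Data.Bool.ListAction using (any)
open import Data.Bool using (Bool; true; false; not; _∧_; if_then_else_)
open import Data.Product using (_×_; _,_; proj₁; proj₂)
open import Relation.Nullary using (Dec; yes; no)
open import Relation.Nullary.Decidable using (⌊_⌋)
open import Relation.Binary.PropositionalEquality using (_≡_)

-- The ring  R n = ℤ_n[x] / ⟨x⁴⟩.
-- An element a₀ + a₁x + a₂x² + a₃x³ is the coefficient vector
-- (a₀ , a₁ , a₂ , a₃) with aᵢ ∈ ℤ_n = Fin n.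

R : ℕ → Set
R n = Vec (Fin n) 4

module _ (n : ℕ) .{{_ : NonZero n}} where

  0R : R n
  0R = (0 mod n) ∷ (0 mod n) ∷ (0 mod n) ∷ (0 mod n) ∷ []

  infixl 7 _·_
  _·_ : R n → R n → R n
  (a0 ∷ a1 ∷ a2 ∷ a3 ∷ []) · (b0 ∷ b1 ∷ b2 ∷ b3 ∷ []) =
      ((toℕ a0 * toℕ b0) mod n)
    ∷ ((toℕ a0 * toℕ b1 + toℕ a1 * toℕ b0) mod n)
    ∷ ((toℕ a0 * toℕ b2 + toℕ a1 * toℕ b1 + toℕ a2 * toℕ b0) mod n)
    ∷ ((toℕ a0 * toℕ b3 + toℕ a1 * toℕ b2 + toℕ a2 * toℕ b1 + toℕ a3 * toℕ b0) mod n)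
    ∷ []

  _≟R_ : (x y : R n) → Dec (x ≡ y)
  _≟R_ = ≡-dec Fin._≟_

  _==_ : R n → R n → Bool
  x == y = ⌊ x ≟R y ⌋

allVecs : (n k : ℕ) → List (Vec (Fin n) k)
allVecs n zero    = [] ∷ []
allVecs n (suc k) = concatMap (λ a → map (a ∷_) (allVecs n k)) (allFin n)

pairs : {A : Set} → List A → List (A × A)
pairs []       = []
pairs (x ∷ xs) = map (x ,_) xs ++ pairs xs

module _ (n : ℕ) .{{_ : NonZero n}} where

  elems : List (R n)
  elems = allVecs n 4

  nonzero : R n → Bool
  nonzero x = not (_==_ n x (0R n))

  isNZZD : R n → Bool
  isNZZD x = nonzero x ∧ any (λ y → nonzero y ∧ _==_ n (_·_ n x y) (0R n)) elems

  V : List (R n)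
  V = filter (λ x → Data.Bool._≟_ (isNZZD x) true) elems

  adj : R n → R n → Bool
  adj x y = not (_==_ n x y) ∧ _==_ n (_·_ n x y) (0R n)

  E : List (R n × R n)
  E = filter (λ e → Data.Bool._≟_ (adj (proj₁ e) (proj₂ e)) true) (pairs V)

  deg : R n → ℕ
  deg x = length (filter (λ y → Data.Bool._≟_ (adj x y) true) V)

  M₁ : ℕ
  M₁ = sum (map (λ e → deg (proj₁ e) + deg (proj₂ e)) E)

  M₂ : ℕ
  M₂ = sum (map (λ e → deg (proj₁ e) * deg (proj₂ e)) E)

  numV : ℕ
  numV = length V

  numE : ℕ
  numE = length E

-- Let v(x) be the number of leading zero coefficients of x ∈ ℤ_p[x]/⟨x⁴⟩, so v(0) = 4. Every x is
-- Xᵛ⁽ˣ⁾·u with u a unit (`shift` is multiplication by X), and as p is prime a product of units is a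
-- unit; hence v(xy) = min 4 (v(x) + v(y)), i.e. xy = 0 iff v(x) + v(y) ≥ 4. So the vertices of Γ
-- are the elements of valuation 1, 2, 3, forming classes of sizes (p−1)p², (p−1)p, p−1, and whether
-- two distinct vertices are adjacent depends only on their classes. Counting neighbours class by
-- class and double counting edges turns |V|, 2|E|, 2M₁ and 2M₂ into polynomials in k = p − 2, and
-- 2·2M₂·|V| − 2M₁·2|E| turns out to be a polynomial in k with nonnegative coefficients.

module Submission where

open import Defs renaming (_·_ to mul; _==_ to equal)
open import Data.Nat using (ℕ; zero; suc; _+_; _*_; _^_; _⊓_; _≤_; _<_; _≤ᵇ_; z≤n; s≤s)
open import Data.Nat.Properties
open import Data.Nat.DivMod using (_mod_)
open import Data.Nat.Divisibility using (_∣_; m%n≡0⇒n∣m; >⇒∤)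
open import Data.Nat.Primality using (Prime; prime⇒nonZero; euclidsLemma; ¬prime[0]; ¬prime[1])
open import Data.Nat.ListAction using (sum)
open import Data.Nat.ListAction.Properties using (sum-++)
open import Data.Nat.Tactic.RingSolver using (solve-∀)
open import Data.Bool using (Bool; true; false; not; _∧_; _∨_)
import Data.Bool as Bool
open import Data.Bool.Properties using (∧-inverseˡ; ∨-zeroʳ)
open import Data.Bool.ListAction using (any)
open import Data.Fin using (Fin; zero; suc; toℕ)
import Data.Fin as Fin
open import Data.Fin.Properties using (toℕ-fromℕ<; toℕ<n)
open import Data.Vec using (Vec; []; _∷_)
open import Data.Vec.Properties using (≡-dec)
open import Data.List using (List; []; _∷_; map; concatMap; filter; length; allFin; _++_)
open import Data.List.Properties using (map-++; map-∘; map-tabulate; length-tabulate)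
open import Data.List.Membership.Propositional using (_∈_; lose)
open import Data.List.Membership.Propositional.Properties using (∈-map⁺; ∈-concatMap⁺; ∈-allFin)
open import Data.List.Relation.Unary.Any using (here; there)
open import Data.Product using (Σ-syntax; _×_; _,_; proj₁; proj₂)
open import Data.Sum using (inj₁; inj₂)
open import Function using (_∘_)
open import Relation.Nullary using (yes; no; does; contradiction)
open import Relation.Nullary.Decidable using (isYes; isYes≗does; dec-true)
open import Relation.Binary.Definitions using (DecidableEquality)
open import Relation.Binary.PropositionalEquality hiding ([_])

∑ : {A : Set} → List A → (A → ℕ) → ℕ
∑ L f = sum (map f L)

infix 5 ∑
syntax ∑ L (λ x → f) = ∑[ x ∈ L ] f

infixr 7 [_]*_
[_]*_ : Bool → ℕ → ℕ
[ true  ]* n = n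
[ false ]* n = 0

[]*-split : ∀ b n → n ≡ [ not b ]* n + [ b ]* n
[]*-split true  n = refl
[]*-split false n = sym (+-identityʳ n)

[]*-comm : ∀ a b n → [ a ]* [ b ]* n ≡ [ b ]* [ a ]* n
[]*-comm true  b     n = refl
[]*-comm false true  n = refl
[]*-comm false false n = refl

[∧]* : ∀ a b n → [ a ∧ b ]* n ≡ [ a ]* [ b ]* n
[∧]* true  b n = refl
[∧]* false b n = refl

module _ {A : Set} where

  ∑-cong : ∀ (L : List A) {f g : A → ℕ} → (∀ x → f x ≡ g x) → ∑ L f ≡ ∑ L g
  ∑-cong []      f≗g = refl
  ∑-cong (x ∷ L) f≗g = cong₂ _+_ (f≗g x) (∑-cong L f≗g)

  ∑-++ : ∀ (xs ys : List A) f → ∑ (xs ++ ys) f ≡ ∑ xs f + ∑ ys f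
  ∑-++ xs ys f = trans (cong sum (map-++ f xs ys)) (sum-++ (map f xs) (map f ys))

  ∑-+ : ∀ (L : List A) f g → (∑[ x ∈ L ] (f x + g x)) ≡ ∑ L f + ∑ L g
  ∑-+ []      f g = refl
  ∑-+ (x ∷ L) f g = trans (cong (f x + g x +_) (∑-+ L f g)) (+-interchange (f x) (g x) (∑ L f) (∑ L g))
    where
    +-interchange : ∀ a b c d → a + b + (c + d) ≡ a + c + (b + d)
    +-interchange = solve-∀

  ∑-zero : ∀ (L : List A) → (∑[ x ∈ L ] 0) ≡ 0
  ∑-zero []      = refl
  ∑-zero (x ∷ L) = ∑-zero L

  ∑-const : ∀ (L : List A) c → (∑[ x ∈ L ] c) ≡ c * length L
  ∑-const []      c = sym (*-zeroʳ c)
  ∑-const (x ∷ L) c = trans (cong (c +_) (∑-const L c)) (sym (*-suc c (length L)))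

  ∑-[]* : ∀ (L : List A) b f → (∑[ x ∈ L ] [ b ]* f x) ≡ [ b ]* ∑ L f
  ∑-[]* L true  f = refl
  ∑-[]* L false f = ∑-zero L

  length≡∑1 : ∀ (L : List A) → length L ≡ (∑[ x ∈ L ] 1)
  length≡∑1 []      = refl
  length≡∑1 (x ∷ L) = cong suc (length≡∑1 L)

  ∑-filter : ∀ (b : A → Bool) (L : List A) f →
             ∑ (filter (λ x → b x Bool.≟ true) L) f ≡ (∑[ x ∈ L ] [ b x ]* f x)
  ∑-filter b []      f = refl
  ∑-filter b (x ∷ L) f with b x
  ... | true  = cong (f x +_) (∑-filter b L f)
  ... | false = ∑-filter b L f

module _ {A B : Set} where

  ∑-map : ∀ (h : A → B) (L : List A) f → ∑ (map h L) f ≡ ∑ L (f ∘ h)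
  ∑-map h L f = cong sum (sym (map-∘ L))

  ∑-concatMap : ∀ (F : A → List B) (L : List A) f → ∑ (concatMap F L) f ≡ (∑[ x ∈ L ] ∑ (F x) f)
  ∑-concatMap F []      f = refl
  ∑-concatMap F (x ∷ L) f = trans (∑-++ (F x) (concatMap F L) f) (cong (∑ (F x) f +_) (∑-concatMap F L f))

module _ {A : Set} where

  any-true : ∀ {f : A → Bool} {x L} → x ∈ L → f x ≡ true → any f L ≡ true
  any-true {f} {L = _ ∷ L} (here refl) fx = cong (_∨ any f L) fx
  any-true {f} (there {x = y} x∈L) fx = trans (cong (f y ∨_) (any-true x∈L fx)) (∨-zeroʳ (f y))

  any-false : ∀ {f : A → Bool} → (∀ x → f x ≡ false) → ∀ L → any f L ≡ false
  any-false f≗false []      = refl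
  any-false f≗false (x ∷ L) rewrite f≗false x = any-false f≗false L

-- Double counting over unordered pairs

module _ {A : Set} (g : A → A → ℕ) (g-sym : ∀ x y → g x y ≡ g y x) where

  ∑∑-pairs : ∀ L → (∑[ x ∈ L ] ∑[ y ∈ L ] g x y)
                     ≡ 2 * (∑[ e ∈ pairs L ] g (proj₁ e) (proj₂ e)) + (∑[ x ∈ L ] g x x)
  ∑∑-pairs []       = refl
  ∑∑-pairs (x ∷ xs) = begin
    g x x + ∑ xs (g x) + (∑[ y ∈ xs ] (g y x + ∑ xs (g y)))
      ≡⟨ cong (g x x + ∑ xs (g x) +_) (∑-+ xs (λ y → g y x) (λ y → ∑ xs (g y))) ⟩
    g x x + ∑ xs (g x) + ((∑[ y ∈ xs ] g y x) + (∑[ y ∈ xs ] ∑ xs (g y)))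
      ≡⟨ cong₂ (λ u v → g x x + ∑ xs (g x) + (u + v)) (∑-cong xs (λ y → g-sym y x)) (∑∑-pairs xs) ⟩
    g x x + ∑ xs (g x) + (∑ xs (g x) + (2 * ∑ (pairs xs) G + ∑ xs diagonal))
      ≡⟨ regroup (g x x) (∑ xs (g x)) (∑ (pairs xs) G) (∑ xs diagonal) ⟩
    2 * (∑ xs (g x) + ∑ (pairs xs) G) + (g x x + ∑ xs diagonal)
      ≡⟨ cong (λ s → 2 * s + (g x x + ∑ xs diagonal)) (sym ∑-pairs-cons) ⟩
    2 * ∑ (pairs (x ∷ xs)) G + ∑ (x ∷ xs) diagonal ∎
    where
    open ≡-Reasoning
    G : A × A → ℕ
    G e = g (proj₁ e) (proj₂ e)
    diagonal : A → ℕ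
    diagonal y = g y y
    ∑-pairs-cons : ∑ (pairs (x ∷ xs)) G ≡ ∑ xs (g x) + ∑ (pairs xs) G
    ∑-pairs-cons = trans (∑-++ (map (x ,_) xs) (pairs xs) G) (cong (_+ ∑ (pairs xs) G) (∑-map (x ,_) xs G))
    regroup : ∀ a b c d → a + b + (b + (2 * c + d)) ≡ 2 * (b + c) + (a + d)
    regroup = solve-∀

module _ {A : Set} (r : A → A → Bool) (r-sym : ∀ x y → r x y ≡ r y x) (r-irrefl : ∀ x → r x x ≡ false) where

  ∑-edges : ∀ L (W : A → A → ℕ) → (∀ x y → W x y ≡ W y x) →
    2 * ∑ (filter (λ e → r (proj₁ e) (proj₂ e) Bool.≟ true) (pairs L)) (λ e → W (proj₁ e) (proj₂ e))
      ≡ (∑[ x ∈ L ] ∑[ y ∈ L ] [ r x y ]* W x y)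
  ∑-edges L W W-sym = begin
    2 * ∑ (filter _ (pairs L)) (λ e → W (proj₁ e) (proj₂ e))
      ≡⟨ cong (2 *_) (∑-filter (λ e → r (proj₁ e) (proj₂ e)) (pairs L) _) ⟩
    2 * (∑[ e ∈ pairs L ] g (proj₁ e) (proj₂ e))
      ≡⟨ sym (+-identityʳ _) ⟩
    2 * (∑[ e ∈ pairs L ] g (proj₁ e) (proj₂ e)) + 0
      ≡⟨ cong (2 * (∑[ e ∈ pairs L ] g (proj₁ e) (proj₂ e)) +_) (sym no-loops) ⟩
    2 * (∑[ e ∈ pairs L ] g (proj₁ e) (proj₂ e)) + (∑[ x ∈ L ] g x x)
      ≡⟨ sym (∑∑-pairs g g-sym L) ⟩
    (∑[ x ∈ L ] ∑[ y ∈ L ] g x y) ∎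
    where
    open ≡-Reasoning
    g : A → A → ℕ
    g x y = [ r x y ]* W x y
    g-sym : ∀ x y → g x y ≡ g y x
    g-sym x y = cong₂ [_]*_ (r-sym x y) (W-sym x y)
    no-loops : (∑[ x ∈ L ] g x x) ≡ 0
    no-loops = trans (∑-cong L (λ x → cong (λ b → [ b ]* W x x) (r-irrefl x))) (∑-zero L)

-- Valuations in ℤ_p[x]/⟨x⁴⟩

valuation : ∀ {n k} → Vec (Fin n) k → ℕ
valuation []          = 0
valuation (zero  ∷ v) = suc (valuation v)
valuation (suc _ ∷ v) = 0

valuation≤length : ∀ {n k} (v : Vec (Fin n) k) → valuation v ≤ k
valuation≤length []          = z≤n
valuation≤length (zero  ∷ v) = s≤s (valuation≤length v)
valuation≤length (suc _ ∷ v) = z≤n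

valuation-nonzero-head : ∀ {n k} {c : Fin (suc n)} (v : Vec (Fin (suc n)) k) → c ≢ zero → valuation (c ∷ v) ≡ 0
valuation-nonzero-head {c = zero}  v c≢0 = contradiction refl c≢0
valuation-nonzero-head {c = suc _} v c≢0 = refl

module _ {m : ℕ} where

  infixl 7 _·_
  _·_ : R (suc m) → R (suc m) → R (suc m)
  _·_ = mul (suc m)

  infix 5 _==_
  _==_ : R (suc m) → R (suc m) → Bool
  _==_ = equal (suc m)

  shift : R (suc m) → R (suc m)
  shift (a₀ ∷ a₁ ∷ a₂ ∷ _ ∷ []) = zero ∷ a₀ ∷ a₁ ∷ a₂ ∷ []

  shiftⁿ : ℕ → R (suc m) → R (suc m)
  shiftⁿ zero    x = x
  shiftⁿ (suc i) x = shift (shiftⁿ i x)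

  shiftⁿ-+ : ∀ i j x → shiftⁿ (i + j) x ≡ shiftⁿ i (shiftⁿ j x)
  shiftⁿ-+ zero    j x = refl
  shiftⁿ-+ (suc i) j x = cong shift (shiftⁿ-+ i j x)

  shift-·ˡ : ∀ x y → shift x · y ≡ shift (x · y)
  shift-·ˡ (_ ∷ _ ∷ _ ∷ _ ∷ []) (_ ∷ _ ∷ _ ∷ _ ∷ []) = refl

  shiftⁿ-·ˡ : ∀ i x y → shiftⁿ i x · y ≡ shiftⁿ i (x · y)
  shiftⁿ-·ˡ zero    x y = refl
  shiftⁿ-·ˡ (suc i) x y = trans (shift-·ˡ (shiftⁿ i x) y) (cong shift (shiftⁿ-·ˡ i x y))

  ·-comm : ∀ x y → x · y ≡ y · x
  ·-comm (a₀ ∷ a₁ ∷ a₂ ∷ a₃ ∷ []) (b₀ ∷ b₁ ∷ b₂ ∷ b₃ ∷ []) =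
    cong₄ (λ c₀ c₁ c₂ c₃ → (c₀ mod suc m) ∷ (c₁ mod suc m) ∷ (c₂ mod suc m) ∷ (c₃ mod suc m) ∷ [])
      (*-comm (toℕ a₀) (toℕ b₀))
      (convolution₂ (toℕ a₀) (toℕ a₁) (toℕ b₀) (toℕ b₁))
      (convolution₃ (toℕ a₀) (toℕ a₁) (toℕ a₂) (toℕ b₀) (toℕ b₁) (toℕ b₂))
      (convolution₄ (toℕ a₀) (toℕ a₁) (toℕ a₂) (toℕ a₃) (toℕ b₀) (toℕ b₁) (toℕ b₂) (toℕ b₃))
    where
    cong₄ : ∀ {A : Set} (f : ℕ → ℕ → ℕ → ℕ → A) {a a′ b b′ c c′ d d′} →
            a ≡ a′ → b ≡ b′ → c ≡ c′ → d ≡ d′ → f a b c d ≡ f a′ b′ c′ d′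
    cong₄ f refl refl refl refl = refl
    convolution₂ : ∀ a₀ a₁ b₀ b₁ → a₀ * b₁ + a₁ * b₀ ≡ b₀ * a₁ + b₁ * a₀
    convolution₂ = solve-∀
    convolution₃ : ∀ a₀ a₁ a₂ b₀ b₁ b₂ → a₀ * b₂ + a₁ * b₁ + a₂ * b₀ ≡ b₀ * a₂ + b₁ * a₁ + b₂ * a₀
    convolution₃ = solve-∀
    convolution₄ : ∀ a₀ a₁ a₂ a₃ b₀ b₁ b₂ b₃ →
                   a₀ * b₃ + a₁ * b₂ + a₂ * b₁ + a₃ * b₀ ≡ b₀ * a₃ + b₁ * a₂ + b₂ * a₁ + b₃ * a₀
    convolution₄ = solve-∀

  shiftⁿ-· : ∀ i j x y → shiftⁿ i x · shiftⁿ j y ≡ shiftⁿ (i + j) (x · y)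
  shiftⁿ-· i j x y = begin
    shiftⁿ i x · shiftⁿ j y      ≡⟨ shiftⁿ-·ˡ i x (shiftⁿ j y) ⟩
    shiftⁿ i (x · shiftⁿ j y)    ≡⟨ cong (shiftⁿ i) (·-comm x (shiftⁿ j y)) ⟩
    shiftⁿ i (shiftⁿ j y · x)    ≡⟨ cong (shiftⁿ i) (shiftⁿ-·ˡ j y x) ⟩
    shiftⁿ i (shiftⁿ j (y · x))  ≡⟨ sym (shiftⁿ-+ i j (y · x)) ⟩
    shiftⁿ (i + j) (y · x)       ≡⟨ cong (shiftⁿ (i + j)) (·-comm y x) ⟩
    shiftⁿ (i + j) (x · y)       ∎
    where open ≡-Reasoning

  valuation-shift : ∀ x → valuation (shift x) ≡ 4 ⊓ suc (valuation x)
  valuation-shift (suc _ ∷ _ ∷ _ ∷ _ ∷ [])       = refl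
  valuation-shift (zero ∷ suc _ ∷ _ ∷ _ ∷ [])    = refl
  valuation-shift (zero ∷ zero ∷ suc _ ∷ _ ∷ []) = refl
  valuation-shift (zero ∷ zero ∷ zero ∷ _ ∷ [])  = refl

  valuation-shiftⁿ : ∀ i x → valuation (shiftⁿ i x) ≡ 4 ⊓ (i + valuation x)
  valuation-shiftⁿ zero    x = sym (m≥n⇒m⊓n≡n (valuation≤length x))
  valuation-shiftⁿ (suc i) x = begin
    valuation (shift (shiftⁿ i x))     ≡⟨ valuation-shift (shiftⁿ i x) ⟩
    4 ⊓ suc (valuation (shiftⁿ i x))   ≡⟨ cong (λ v → 4 ⊓ suc v) (valuation-shiftⁿ i x) ⟩
    4 ⊓ (5 ⊓ suc (i + valuation x))    ≡⟨ sym (⊓-assoc 4 5 _) ⟩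
    4 ⊓ suc (i + valuation x)          ∎
    where open ≡-Reasoning

  ==0R-valuation : ∀ x → x == 0R (suc m) ≡ (4 ≤ᵇ valuation x)
  ==0R-valuation (suc _ ∷ _ ∷ _ ∷ _ ∷ [])          = refl
  ==0R-valuation (zero ∷ suc _ ∷ _ ∷ _ ∷ [])       = refl
  ==0R-valuation (zero ∷ zero ∷ suc _ ∷ _ ∷ [])    = refl
  ==0R-valuation (zero ∷ zero ∷ zero ∷ suc _ ∷ []) = refl
  ==0R-valuation (zero ∷ zero ∷ zero ∷ zero ∷ [])  = refl

-- For x = 0 (valuation 4) any unit will do, since X⁴ = 0.
unit-factorisation : ∀ {k} (x : R (suc (suc k))) →
                     Σ[ a ∈ Fin (suc k) ] Σ[ u ∈ Vec (Fin (suc (suc k))) 3 ] x ≡ shiftⁿ (valuation x) (suc a ∷ u)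
unit-factorisation (suc a ∷ u)                       = a , u , refl
unit-factorisation (zero ∷ suc a ∷ u₂ ∷ u₃ ∷ [])     = a , u₂ ∷ u₃ ∷ zero ∷ [] , refl
unit-factorisation (zero ∷ zero ∷ suc a ∷ u₃ ∷ [])   = a , u₃ ∷ zero ∷ zero ∷ [] , refl
unit-factorisation (zero ∷ zero ∷ zero ∷ suc a ∷ []) = a , zero ∷ zero ∷ zero ∷ [] , refl
unit-factorisation (zero ∷ zero ∷ zero ∷ zero ∷ [])  = zero , zero ∷ zero ∷ zero ∷ [] , refl

4≤ᵇ4⊓n : ∀ n → (4 ≤ᵇ 4 ⊓ n) ≡ (4 ≤ᵇ n)
4≤ᵇ4⊓n 0 = refl
4≤ᵇ4⊓n 1 = refl
4≤ᵇ4⊓n 2 = refl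
4≤ᵇ4⊓n 3 = refl
4≤ᵇ4⊓n (suc (suc (suc (suc n)))) = refl

module _ {k : ℕ} (prime : Prime (suc (suc k))) where

  mod-prime-product≢0 : ∀ (a b : Fin (suc k)) → (toℕ (suc a) * toℕ (suc b)) mod suc (suc k) ≢ zero
  mod-prime-product≢0 a b ≡0 with euclidsLemma (toℕ (suc a)) (toℕ (suc b)) prime p∣ab
    where
    p∣ab : suc (suc k) ∣ toℕ (suc a) * toℕ (suc b)
    p∣ab = m%n≡0⇒n∣m _ (suc (suc k)) (trans (sym (toℕ-fromℕ< _)) (cong toℕ ≡0))
  ... | inj₁ p∣a = >⇒∤ (s≤s (toℕ<n a)) p∣a
  ... | inj₂ p∣b = >⇒∤ (s≤s (toℕ<n b)) p∣b

  valuation-unit-· : ∀ (a b : Fin (suc k)) u w → valuation ((suc a ∷ u) · (suc b ∷ w)) ≡ 0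
  valuation-unit-· a b (_ ∷ _ ∷ _ ∷ []) (_ ∷ _ ∷ _ ∷ []) = valuation-nonzero-head _ (mod-prime-product≢0 a b)

  valuation-· : ∀ x y → valuation (x · y) ≡ 4 ⊓ (valuation x + valuation y)
  valuation-· x y with unit-factorisation x | unit-factorisation y
  ... | a , u , x≡ | b , w , y≡ = begin
    valuation (x · y)
      ≡⟨ cong₂ (λ x y → valuation (x · y)) x≡ y≡ ⟩
    valuation (shiftⁿ i (suc a ∷ u) · shiftⁿ j (suc b ∷ w))
      ≡⟨ cong valuation (shiftⁿ-· i j (suc a ∷ u) (suc b ∷ w)) ⟩
    valuation (shiftⁿ (i + j) ((suc a ∷ u) · (suc b ∷ w)))
      ≡⟨ valuation-shiftⁿ (i + j) _ ⟩
    4 ⊓ (i + j + valuation ((suc a ∷ u) · (suc b ∷ w)))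
      ≡⟨ cong (λ v → 4 ⊓ (i + j + v)) (valuation-unit-· a b u w) ⟩
    4 ⊓ (i + j + 0)
      ≡⟨ cong (4 ⊓_) (+-identityʳ (i + j)) ⟩
    4 ⊓ (i + j) ∎
    where
    open ≡-Reasoning
    i j : ℕ
    i = valuation x
    j = valuation y

  ·==0R-valuation : ∀ x y → x · y == 0R (suc (suc k)) ≡ (4 ≤ᵇ valuation x + valuation y)
  ·==0R-valuation x y = trans (==0R-valuation (x · y))
                    (trans (cong (4 ≤ᵇ_) (valuation-· x y)) (4≤ᵇ4⊓n (valuation x + valuation y)))

∈-allVecs : ∀ {n k} (v : Vec (Fin n) k) → v ∈ allVecs n k
∈-allVecs []      = here refl
∈-allVecs {n} {suc k} (a ∷ v) =
  ∈-concatMap⁺ (λ b → map (b ∷_) (allVecs n k)) (lose (∈-allFin a) (∈-map⁺ (a ∷_) (∈-allVecs v)))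

allFin-suc : ∀ n → allFin (suc n) ≡ zero ∷ map suc (allFin n)
allFin-suc n = cong (zero ∷_) (sym (map-tabulate (λ i → i) suc))

∑-allFin-suc : ∀ n (g : Fin (suc n) → ℕ) → ∑ (allFin (suc n)) g ≡ g zero + ∑ (allFin n) (g ∘ suc)
∑-allFin-suc n g = trans (cong (λ L → ∑ L g) (allFin-suc n)) (cong (g zero +_) (∑-map suc (allFin n) g))

count-allFin : ∀ {n} (x : Fin n) (g : Fin n → ℕ) → (∑[ a ∈ allFin n ] [ does (x Fin.≟ a) ]* g a) ≡ g x
count-allFin {suc n} zero    g = begin
  ∑ (allFin (suc n)) _                    ≡⟨ ∑-allFin-suc n _ ⟩
  g zero + (∑[ a ∈ allFin n ] 0)          ≡⟨ cong (g zero +_) (∑-zero (allFin n)) ⟩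
  g zero + 0                              ≡⟨ +-identityʳ (g zero) ⟩
  g zero                                  ∎
  where open ≡-Reasoning
count-allFin {suc n} (suc x) g =
  trans (∑-allFin-suc n (λ a → [ does (suc x Fin.≟ a) ]* g a)) (count-allFin x (g ∘ suc))

count-allVecs : ∀ {n k} (x : Vec (Fin n) k) (h : Vec (Fin n) k → ℕ) →
                (∑[ v ∈ allVecs n k ] [ does (≡-dec Fin._≟_ x v) ]* h v) ≡ h x
count-allVecs []       h = +-identityʳ (h [])
count-allVecs {n} {suc k} (x₀ ∷ xs) h = begin
  ∑ (concatMap (λ a → map (a ∷_) (allVecs n k)) (allFin n)) _
    ≡⟨ ∑-concatMap (λ a → map (a ∷_) (allVecs n k)) (allFin n) _ ⟩
  (∑[ a ∈ allFin n ] ∑ (map (a ∷_) (allVecs n k)) _)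
    ≡⟨ ∑-cong (allFin n) (λ a → trans (∑-map (a ∷_) (allVecs n k) _) (inner a)) ⟩
  (∑[ a ∈ allFin n ] [ does (x₀ Fin.≟ a) ]* (∑[ v ∈ allVecs n k ] [ does (≡-dec Fin._≟_ xs v) ]* h (a ∷ v)))
    ≡⟨ count-allFin x₀ (λ a → ∑[ v ∈ allVecs n k ] [ does (≡-dec Fin._≟_ xs v) ]* h (a ∷ v)) ⟩
  (∑[ v ∈ allVecs n k ] [ does (≡-dec Fin._≟_ xs v) ]* h (x₀ ∷ v))
    ≡⟨ count-allVecs xs (λ v → h (x₀ ∷ v)) ⟩
  h (x₀ ∷ xs) ∎
  where
  open ≡-Reasoning
  inner : ∀ a → (∑[ v ∈ allVecs n k ] [ does (x₀ Fin.≟ a) ∧ does (≡-dec Fin._≟_ xs v) ]* h (a ∷ v))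
                ≡ [ does (x₀ Fin.≟ a) ]* (∑[ v ∈ allVecs n k ] [ does (≡-dec Fin._≟_ xs v) ]* h (a ∷ v))
  inner a = trans (∑-cong (allVecs n k) (λ v → [∧]* (does (x₀ Fin.≟ a)) _ _)) (∑-[]* (allVecs n k) _ _)

length-allVecs : ∀ n j → length (allVecs n j) ≡ n ^ j
length-allVecs n zero    = refl
length-allVecs n (suc j) = begin
  length (concatMap (λ a → map (a ∷_) (allVecs n j)) (allFin n))
    ≡⟨ length≡∑1 (concatMap (λ a → map (a ∷_) (allVecs n j)) (allFin n)) ⟩
  (∑[ v ∈ concatMap (λ a → map (a ∷_) (allVecs n j)) (allFin n) ] 1)
    ≡⟨ ∑-concatMap (λ a → map (a ∷_) (allVecs n j)) (allFin n) _ ⟩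
  (∑[ a ∈ allFin n ] ∑[ v ∈ map (a ∷_) (allVecs n j) ] 1)
    ≡⟨ ∑-cong (allFin n) (λ a → trans (∑-map (a ∷_) (allVecs n j) _) (sym (length≡∑1 (allVecs n j)))) ⟩
  (∑[ a ∈ allFin n ] length (allVecs n j))
    ≡⟨ ∑-const (allFin n) _ ⟩
  length (allVecs n j) * length (allFin n)
    ≡⟨ cong₂ _*_ (length-allVecs n j) (length-tabulate (λ i → i)) ⟩
  n ^ j * n
    ≡⟨ *-comm (n ^ j) n ⟩
  n ^ suc j ∎
  where open ≡-Reasoning

module _ {m : ℕ} where

  valuationSum : ℕ → (ℕ → ℕ) → ℕ
  valuationSum zero    g = g 0
  valuationSum (suc j) g = valuationSum j (g ∘ suc) + g 0 * suc m ^ j * m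

  ∑-valuation : ∀ j g → (∑[ v ∈ allVecs (suc m) j ] g (valuation v)) ≡ valuationSum j g
  ∑-valuation zero    g = +-identityʳ (g 0)
  ∑-valuation (suc j) g = begin
    ∑ (concatMap (λ a → map (a ∷_) (allVecs (suc m) j)) (allFin (suc m))) (g ∘ valuation)
      ≡⟨ ∑-concatMap (λ a → map (a ∷_) (allVecs (suc m) j)) (allFin (suc m)) _ ⟩
    (∑[ a ∈ allFin (suc m) ] ∑ (map (a ∷_) (allVecs (suc m) j)) (g ∘ valuation))
      ≡⟨ ∑-allFin-suc m _ ⟩
    ∑ (map (zero ∷_) (allVecs (suc m) j)) (g ∘ valuation)
      + (∑[ a ∈ allFin m ] ∑ (map (suc a ∷_) (allVecs (suc m) j)) (g ∘ valuation))
      ≡⟨ cong₂ _+_ (trans (∑-map (zero ∷_) (allVecs (suc m) j) (g ∘ valuation)) (∑-valuation j (g ∘ suc)))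
                   (∑-cong (allFin m) (λ a → trans (∑-map (suc a ∷_) (allVecs (suc m) j) (g ∘ valuation))
                                                   (∑-const (allVecs (suc m) j) (g 0)))) ⟩
    valuationSum j (g ∘ suc) + (∑[ a ∈ allFin m ] g 0 * length (allVecs (suc m) j))
      ≡⟨ cong (valuationSum j (g ∘ suc) +_) (∑-const (allFin m) _) ⟩
    valuationSum j (g ∘ suc) + g 0 * length (allVecs (suc m) j) * length (allFin m)
      ≡⟨ cong₂ (λ s t → valuationSum j (g ∘ suc) + g 0 * s * t)
               (length-allVecs (suc m) j) (length-tabulate (λ i → i)) ⟩
    valuationSum j (g ∘ suc) + g 0 * suc m ^ j * m ∎
    where open ≡-Reasoning

  ∑-without : ∀ (x : R (suc m)) h →
              (∑[ y ∈ elems (suc m) ] [ not (x == y) ]* h y) + h x ≡ ∑ (elems (suc m)) h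
  ∑-without x h = begin
    ∑ L (λ y → [ not (x == y) ]* h y) + h x
      ≡⟨ cong (∑ L (λ y → [ not (x == y) ]* h y) +_) (sym (trans (∑-cong L ==≗does) (count-allVecs x h))) ⟩
    ∑ L (λ y → [ not (x == y) ]* h y) + ∑ L (λ y → [ x == y ]* h y)
      ≡⟨ sym (∑-+ L (λ y → [ not (x == y) ]* h y) (λ y → [ x == y ]* h y)) ⟩
    ∑ L (λ y → [ not (x == y) ]* h y + [ x == y ]* h y)
      ≡⟨ ∑-cong L (λ y → sym ([]*-split (x == y) (h y))) ⟩
    ∑ L h ∎
    where
    open ≡-Reasoning
    L : List (R (suc m))
    L = elems (suc m)
    ==≗does : ∀ y → [ x == y ]* h y ≡ [ does (≡-dec Fin._≟_ x y) ]* h y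
    ==≗does y = cong (λ b → [ b ]* h y) (isYes≗does (_≟R_ (suc m) x y))

-- The vertex classes Aᵢ = {x | valuation x = i}, i = 1, 2, 3, for p = k + 2

isVertexClass : ℕ → Bool
isVertexClass c = not (4 ≤ᵇ c) ∧ (1 ≤ᵇ c)

module VertexClasses (k : ℕ) where

  m p n₁ n₂ n₃ : ℕ
  m  = suc k
  p  = suc m
  n₁ = m * p * p
  n₂ = m * p
  n₃ = m

  vertexClassSum : (ℕ → ℕ) → ℕ
  vertexClassSum g = g 1 * n₁ + g 2 * n₂ + g 3 * n₃

  -- The neighbours of x ∈ A₁ form A₃, those of x ∈ A₂ form (A₂ ∖ {x}) ∪ A₃, those of x ∈ A₃
  -- form V ∖ {x}, and 0 is adjacent to all of V; n₂ − 1 and n₃ − 1 appear as m + k * p and k.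
  neighbourSum : ℕ → (ℕ → ℕ) → ℕ
  neighbourSum 0 F = 0
  neighbourSum 1 F = F 3 * n₃
  neighbourSum 2 F = F 2 * (m + k * p) + F 3 * n₃
  neighbourSum 3 F = F 1 * n₁ + F 2 * n₂ + F 3 * k
  neighbourSum (suc (suc (suc (suc _)))) F = F 1 * n₁ + F 2 * n₂ + F 3 * n₃

  degree : ℕ → ℕ
  degree c = neighbourSum c (λ _ → 1)

  classAdjacencySum : (ℕ → ℕ → ℕ) → ℕ
  classAdjacencySum W = vertexClassSum (λ c → neighbourSum c (W c))

  valuationSum-vertices : ∀ g → valuationSum {m} 4 (λ c → [ isVertexClass c ]* g c) ≡ vertexClassSum g
  valuationSum-vertices g = regroup m p (g 1) (g 2) (g 3)
    where
    -- the left side is valuationSum 4 with the powers of p unfolded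
    regroup : ∀ m p a b c → c * 1 * m + b * (p * 1) * m + a * (p * (p * 1)) * m + 0
                            ≡ a * (m * p * p) + b * (m * p) + c * m
    regroup = solve-∀

  ∑-vertexClasses : ∀ g → (∑[ x ∈ elems p ] [ isVertexClass (valuation x) ]* g (valuation x)) ≡ vertexClassSum g
  ∑-vertexClasses g = trans (∑-valuation 4 (λ c → [ isVertexClass c ]* g c)) (valuationSum-vertices g)

  neighbourSum+self : ∀ c F → [ isVertexClass c ]* [ 4 ≤ᵇ c + c ]* F c + neighbourSum c F
                              ≡ vertexClassSum (λ j → [ 4 ≤ᵇ c + j ]* F j)
  neighbourSum+self 0 F = refl
  neighbourSum+self 1 F = refl
  neighbourSum+self 2 F = trans (sym (+-assoc (F 2) _ _)) (cong (_+ F 3 * n₃) (sym (*-suc (F 2) (m + k * p))))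
  neighbourSum+self 3 F = trans (+-comm (F 3) _) (trans (+-assoc (F 1 * n₁ + F 2 * n₂) _ _)
                            (cong (F 1 * n₁ + F 2 * n₂ +_) (trans (+-comm (F 3 * k) (F 3)) (sym (*-suc (F 3) k)))))
  neighbourSum+self (suc (suc (suc (suc _)))) F = refl

-- The zero-divisor graph Γ(ℤ_p[x]/⟨x⁴⟩)

isYes-sym : ∀ {A : Set} (_≟_ : DecidableEquality A) x y → isYes (x ≟ y) ≡ isYes (y ≟ x)
isYes-sym _≟_ x y with x ≟ y | y ≟ x
... | yes _   | yes _   = refl
... | no  _   | no  _   = refl
... | yes x≡y | no  y≢x = contradiction (sym x≡y) y≢x
... | no  x≢y | yes y≡x = contradiction (sym y≡x) x≢y

module _ {k : ℕ} (prime : Prime (suc (suc k))) where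

  open VertexClasses k

  X³ : R p
  X³ = zero ∷ zero ∷ zero ∷ suc zero ∷ []

  has-nonzero-annihilator : ∀ x → any (λ y → nonzero p y ∧ (x · y == 0R p)) (elems p) ≡ (1 ≤ᵇ valuation x)
  has-nonzero-annihilator x with valuation x in vx≡
  ... | zero  = any-false no-annihilator (elems p)
    where
    no-annihilator : ∀ y → nonzero p y ∧ (x · y == 0R p) ≡ false
    no-annihilator y = begin
      not (y == 0R p) ∧ (x · y == 0R p)
        ≡⟨ cong₂ (λ a b → not a ∧ b) (==0R-valuation y) (·==0R-valuation prime x y) ⟩
      not (4 ≤ᵇ valuation y) ∧ (4 ≤ᵇ valuation x + valuation y)
        ≡⟨ cong (λ v → not (4 ≤ᵇ valuation y) ∧ (4 ≤ᵇ v + valuation y)) vx≡ ⟩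
      not (4 ≤ᵇ valuation y) ∧ (4 ≤ᵇ valuation y)
        ≡⟨ ∧-inverseˡ (4 ≤ᵇ valuation y) ⟩
      false ∎
      where open ≡-Reasoning
  ... | suc i = any-true {f = λ y → nonzero p y ∧ (x · y == 0R p)} (∈-allVecs X³)
                  (trans (·==0R-valuation prime x X³) (cong (4 ≤ᵇ_) (trans (cong (_+ 3) vx≡) (+-comm (suc i) 3))))

  isNZZD≡isVertexClass : ∀ x → isNZZD p x ≡ isVertexClass (valuation x)
  isNZZD≡isVertexClass x = cong₂ _∧_ (cong not (==0R-valuation x)) (has-nonzero-annihilator x)

  adj-valuation : ∀ x y → adj p x y ≡ not (x == y) ∧ (4 ≤ᵇ valuation x + valuation y)
  adj-valuation x y = cong (not (x == y) ∧_) (·==0R-valuation prime x y)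

  adj-sym : ∀ x y → adj p x y ≡ adj p y x
  adj-sym x y = cong₂ (λ a b → not a ∧ b) (isYes-sym (_≟R_ p) x y) (cong (λ z → z == 0R p) (·-comm x y))

  adj-irrefl : ∀ x → adj p x x ≡ false
  adj-irrefl x =
    cong (λ b → not b ∧ (x · x == 0R p)) (trans (isYes≗does (_≟R_ p x x)) (dec-true (_≟R_ p x x) refl))

  ∑-vertices : ∀ g → (∑[ x ∈ V p ] g (valuation x)) ≡ vertexClassSum g
  ∑-vertices g = begin
    (∑[ x ∈ V p ] g (valuation x))
      ≡⟨ ∑-filter (isNZZD p) (elems p) _ ⟩
    (∑[ x ∈ elems p ] [ isNZZD p x ]* g (valuation x))
      ≡⟨ ∑-cong (elems p) (λ x → cong (λ b → [ b ]* g (valuation x)) (isNZZD≡isVertexClass x)) ⟩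
    (∑[ x ∈ elems p ] [ isVertexClass (valuation x) ]* g (valuation x))
      ≡⟨ ∑-vertexClasses g ⟩
    vertexClassSum g ∎
    where open ≡-Reasoning

  ∑-neighbours : ∀ x F → (∑[ y ∈ V p ] [ adj p x y ]* F (valuation y)) ≡ neighbourSum (valuation x) F
  ∑-neighbours x F = +-cancelˡ-≡ (H x) _ _ (begin
    H x + (∑[ y ∈ V p ] [ adj p x y ]* F (valuation y))
      ≡⟨ cong (H x +_) (trans (∑-filter (isNZZD p) (elems p) _) (∑-cong (elems p) reorder)) ⟩
    H x + (∑[ y ∈ elems p ] [ not (x == y) ]* H y)
      ≡⟨ trans (+-comm (H x) _) (∑-without x H) ⟩
    ∑ (elems p) H
      ≡⟨ ∑-vertexClasses (λ j → [ 4 ≤ᵇ c + j ]* F j) ⟩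
    vertexClassSum (λ j → [ 4 ≤ᵇ c + j ]* F j)
      ≡⟨ sym (neighbourSum+self c F) ⟩
    H x + neighbourSum c F ∎)
    where
    open ≡-Reasoning
    c : ℕ
    c = valuation x
    H : R p → ℕ
    H y = [ isVertexClass (valuation y) ]* [ 4 ≤ᵇ c + valuation y ]* F (valuation y)
    reorder : ∀ y → [ isNZZD p y ]* [ adj p x y ]* F (valuation y) ≡ [ not (x == y) ]* H y
    reorder y = begin
      [ isNZZD p y ]* [ adj p x y ]* F (valuation y)
        ≡⟨ cong₂ (λ a b → [ a ]* [ b ]* F (valuation y)) (isNZZD≡isVertexClass y) (adj-valuation x y) ⟩
      [ isVertexClass (valuation y) ]* [ not (x == y) ∧ (4 ≤ᵇ c + valuation y) ]* F (valuation y)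
        ≡⟨ cong ([ isVertexClass (valuation y) ]*_) ([∧]* (not (x == y)) _ _) ⟩
      [ isVertexClass (valuation y) ]* [ not (x == y) ]* [ 4 ≤ᵇ c + valuation y ]* F (valuation y)
        ≡⟨ []*-comm (isVertexClass (valuation y)) (not (x == y)) _ ⟩
      [ not (x == y) ]* H y ∎

  deg≡degree : ∀ x → deg p x ≡ degree (valuation x)
  deg≡degree x = begin
    deg p x
      ≡⟨ length≡∑1 (filter (λ y → adj p x y Bool.≟ true) (V p)) ⟩
    ∑ (filter (λ y → adj p x y Bool.≟ true) (V p)) (λ _ → 1)
      ≡⟨ ∑-filter (adj p x) (V p) (λ _ → 1) ⟩
    (∑[ y ∈ V p ] [ adj p x y ]* 1)
      ≡⟨ ∑-neighbours x (λ _ → 1) ⟩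
    degree (valuation x) ∎
    where open ≡-Reasoning

  ∑-edge-degrees : ∀ (f : ℕ → ℕ → ℕ) → (∀ a b → f a b ≡ f b a) →
    2 * (∑[ e ∈ E p ] f (deg p (proj₁ e)) (deg p (proj₂ e)))
      ≡ classAdjacencySum (λ c j → f (degree c) (degree j))
  ∑-edge-degrees f f-sym = begin
    2 * (∑[ e ∈ E p ] f (deg p (proj₁ e)) (deg p (proj₂ e)))
      ≡⟨ ∑-edges (adj p) adj-sym adj-irrefl (V p) (λ x y → f (deg p x) (deg p y))
                 (λ x y → f-sym (deg p x) (deg p y)) ⟩
    (∑[ x ∈ V p ] ∑[ y ∈ V p ] [ adj p x y ]* f (deg p x) (deg p y))
      ≡⟨ ∑-cong (V p) (λ x → ∑-cong (V p) (λ y →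
           cong (λ n → [ adj p x y ]* n) (cong₂ f (deg≡degree x) (deg≡degree y)))) ⟩
    (∑[ x ∈ V p ] ∑[ y ∈ V p ] [ adj p x y ]* f (degree (valuation x)) (degree (valuation y)))
      ≡⟨ ∑-cong (V p) (λ x → ∑-neighbours x (λ j → f (degree (valuation x)) (degree j))) ⟩
    (∑[ x ∈ V p ] neighbourSum (valuation x) (λ j → f (degree (valuation x)) (degree j)))
      ≡⟨ ∑-vertices (λ c → neighbourSum c (λ j → f (degree c) (degree j))) ⟩
    classAdjacencySum (λ c j → f (degree c) (degree j)) ∎
    where open ≡-Reasoning

  numV≡ : numV p ≡ vertexClassSum (λ _ → 1)
  numV≡ = trans (length≡∑1 (V p)) (∑-vertices (λ _ → 1))

  twice-numE≡ : 2 * numE p ≡ classAdjacencySum (λ _ _ → 1)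
  twice-numE≡ = trans (cong (2 *_) (length≡∑1 (E p))) (∑-edge-degrees (λ _ _ → 1) (λ _ _ → refl))

  twice-M₁≡ : 2 * M₁ p ≡ classAdjacencySum (λ c j → degree c + degree j)
  twice-M₁≡ = ∑-edge-degrees _+_ +-comm

  twice-M₂≡ : 2 * M₂ p ≡ classAdjacencySum (λ c j → degree c * degree j)
  twice-M₂≡ = ∑-edge-degrees _*_ *-comm

-- The let-bindings spell out vertexClassSum and classAdjacencySum of VertexClasses k, so the two
-- sides are definitionally 2M₁·2|E| + (m p)² S(k) and 2·2M₂·|V|.
zagreb-polynomial-identity : ∀ k →
  let m = suc k; p = suc m; n₁ = m * p * p; n₂ = m * p; n₃ = m
      d₁ = 1 * n₃
      d₂ = 1 * (m + k * p) + 1 * n₃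
      d₃ = 1 * n₁ + 1 * n₂ + 1 * k
      edgeSum : ℕ → ℕ → ℕ → ℕ → ℕ → ℕ → ℕ
      edgeSum w₁₃ w₂₂ w₂₃ w₃₁ w₃₂ w₃₃ =
        w₁₃ * n₃ * n₁ + (w₂₂ * (m + k * p) + w₂₃ * n₃) * n₂ + (w₃₁ * n₁ + w₃₂ * n₂ + w₃₃ * k) * n₃
      nV = 1 * n₁ + 1 * n₂ + 1 * n₃
      twoE = edgeSum 1 1 1 1 1 1
      twoM₁ = edgeSum (d₁ + d₃) (d₂ + d₂) (d₂ + d₃) (d₃ + d₁) (d₃ + d₂) (d₃ + d₃)
      twoM₂ = edgeSum (d₁ * d₃) (d₂ * d₂) (d₂ * d₃) (d₃ * d₁) (d₃ * d₂) (d₃ * d₃)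
      S = 28 + k * (268 + k * (838 + k * (1216 + k * (910 + k * (364 + k * (74 + k * 6))))))
  in twoM₁ * twoE + n₂ * n₂ * S ≡ 2 * twoM₂ * nV
zagreb-polynomial-identity = solve-∀

halved-product-≤ : ∀ a b c d {A B C D r} → 2 * a ≡ A → 2 * b ≡ B → 2 * c ≡ C → d ≡ D →
                   A * B + r ≡ 2 * C * D → a * b ≤ c * d
halved-product-≤ a b c d {r = r} refl refl refl refl eq = *-cancelˡ-≤ 4 (begin
  4 * (a * b)          ≡⟨ regroupˡ a b ⟩
  2 * a * (2 * b)      ≤⟨ m≤m+n _ r ⟩
  2 * a * (2 * b) + r  ≡⟨ eq ⟩
  2 * (2 * c) * d      ≡⟨ regroupʳ c d ⟩
  4 * (c * d)          ∎)
  where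
  open ≤-Reasoning
  regroupˡ : ∀ x y → 4 * (x * y) ≡ 2 * x * (2 * y)
  regroupˡ = solve-∀
  regroupʳ : ∀ x y → 2 * (2 * x) * y ≡ 4 * (x * y)
  regroupʳ = solve-∀

mainTheorem7 : (p : ℕ) → (pr : Prime p) →
    (0 < numV p {{prime⇒nonZero pr}}) × (0 < numE p {{prime⇒nonZero pr}}) ×
    (M₁ p {{prime⇒nonZero pr}} * numE p {{prime⇒nonZero pr}}
      ≤ M₂ p {{prime⇒nonZero pr}} * numV p {{prime⇒nonZero pr}})
mainTheorem7 0 pr = contradiction pr ¬prime[0]
mainTheorem7 1 pr = contradiction pr ¬prime[1]
mainTheorem7 p@(suc (suc k)) pr =
    subst (0 <_) (sym (numV≡ pr)) (s≤s z≤n)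
  , *-cancelˡ-< 2 0 _ (subst (0 <_) (sym (twice-numE≡ pr)) (s≤s z≤n))
  , halved-product-≤ (M₁ p) (numE p) (M₂ p) (numV p)
      (twice-M₁≡ pr) (twice-numE≡ pr) (twice-M₂≡ pr) (numV≡ pr) (zagreb-polynomial-identity k)
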